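{- For any integers $t\ge c\ge 2$, $\chi(t,c)\ge 2(c-1)$.
   Context: A hypergraph $G$ consists of a finite vertex set together with a collection of subsets of it (edges). For an integer $c\ge 2$, a $c$-strong coloring of $G$ is an assignment of colors to its vertices such that every edge $e$ of $G$ contains vertices of at least $\min\{c,|e|\}$ distinct colors. $G$ is $t$-intersecting if every two edges of $G$ have at least $t$ vertices in common. For integers $c\ge 2$, $t\ge 0$, $\chi(t,c)$ denotes the minimum number of colors that suffices to $c$-strong color every $t$-intersecting hypergraph ($\infty$ if no finite number suffices). -}

module Defs where

open import Data.Nat using (ℕ; _⊓_; _≤_)
open import Data.Fin using (Fin; _≟_)
open import Data.Fin.Subset using (Subset; _∩_; ∣_∣)
open import Data.Fin.Subset.Properties using (_∈?_)
open import Data.Fin.Properties using (any?)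
open import Data.List using (List)
open import Data.List.Membership.Propositional using (_∈_)
open import Data.Vec using (tabulate)
open import Data.Product using (Σ)
open import Relation.Nullary using (does)
open import Relation.Nullary.Decidable using (_×-dec_)

record Hypergraph : Set where
  field
    n     : ℕ
    edges : List (Subset n)

open Hypergraph public

IsIntersecting : ℕ → Hypergraph → Set
IsIntersecting t H = ∀ e f → e ∈ edges H → f ∈ edges H → t ≤ ∣ e ∩ f ∣

colorsOf : {n k : ℕ} → (Fin n → Fin k) → Subset n → Subset k
colorsOf col e = tabulate (λ j → does (any? (λ i → (i ∈? e) ×-dec (col i ≟ j))))

IsStrongColoring : (c : ℕ) (H : Hypergraph) {k : ℕ} → (Fin (n H) → Fin k) → Set
IsStrongColoring c H col = ∀ e → e ∈ edges H → c ⊓ ∣ e ∣ ≤ ∣ colorsOf col e ∣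

StronglyColorable : (c k : ℕ) → Hypergraph → Set
StronglyColorable c k H = Σ (Fin (n H) → Fin k) (IsStrongColoring c H)

-- Take the (2c−3)t vertices and as edges all sets of at least (c−1)t of them;
-- two edges together exceed the vertex count by t, so they share t vertices.
-- Given k ≤ 2c−3 colours, an averaging argument finds c−1 colour classes
-- holding a fraction (c−1)/k ≥ (c−1)/(2c−3) of the vertices, i.e. at least
-- (c−1)t of them. Their union is an edge of size at least t ≥ c that sees
-- only c−1 colours.
module Submission where

open import Defs
open import Data.Nat using (ℕ; _≤_; _<_; _*_; _∸_; _+_; suc; zero; z≤n; s≤s; _≤?_; NonZero; _⊓_)
open import Data.Product using (Σ; _×_; _,_; proj₂; ∃-syntax)
open import Relation.Nullary using (¬_; yes; no)

open import Data.Bool using (Bool)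
open import Data.Fin using (Fin; zero; suc; _≟_)
open import Data.Fin.Properties using (any?)
open import Data.Fin.Subset
  using (Subset; inside; outside; ⊥; ⊤; ⁅_⁆; _∩_; _∪_; _⊆_; ∣_∣)
  renaming (_∈_ to _∈ˢ_)
open import Data.Fin.Subset.Properties
  using (_∈?_; ∣⊥∣≡0; ∣⊤∣≡n; ∣p∣≤n; p⊆q⇒∣p∣≤∣q∣; ∪-identityˡ; ∩-zeroˡ)
open import Data.List as List using (List; [_]; filter; cartesianProductWith)
open import Data.List.Membership.Propositional using (_∈_)
open import Data.List.Membership.Propositional.Properties
  using (∈-cartesianProductWith⁺; ∈-filter⁺; ∈-filter⁻)
open import Data.List.Relation.Unary.Any using (here; there)
open import Data.Nat.Properties hiding (_≟_)
open import Algebra.Properties.CommutativeSemigroup *-commutativeSemigroup using (x∙yz≈y∙xz)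
open import Data.Nat.Tactic.RingSolver using (solve-∀)
open import Data.Sum using (inj₁; inj₂)
open import Data.Vec using ([]; _∷_; lookup; tabulate; zipWith; replicate)
open import Data.Vec.Properties
  using (lookup∘tabulate; tabulate∘lookup; tabulate-cong; lookup-zipWith;
         lookup-replicate; []=⇒lookup; lookup⇒[]=)
open import Function using (_∘_)
open import Relation.Binary.PropositionalEquality
  using (_≡_; refl; sym; trans; cong; subst; subst₂; module ≡-Reasoning)
open import Relation.Nullary.Decidable using (_×-dec_)

private
  variable
    N k : ℕ

∣p∪q∣+∣p∩q∣≡∣p∣+∣q∣ : (p q : Subset N) → (∣ p ∪ q ∣) + (∣ p ∩ q ∣) ≡ (∣ p ∣) + (∣ q ∣)
∣p∪q∣+∣p∩q∣≡∣p∣+∣q∣ [] [] = refl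
∣p∪q∣+∣p∩q∣≡∣p∣+∣q∣ (inside ∷ p) (inside ∷ q) =
  cong suc (trans (+-suc _ _) (trans (cong suc (∣p∪q∣+∣p∩q∣≡∣p∣+∣q∣ p q)) (sym (+-suc _ _))))
∣p∪q∣+∣p∩q∣≡∣p∣+∣q∣ (inside ∷ p) (outside ∷ q) = cong suc (∣p∪q∣+∣p∩q∣≡∣p∣+∣q∣ p q)
∣p∪q∣+∣p∩q∣≡∣p∣+∣q∣ (outside ∷ p) (inside ∷ q) =
  trans (cong suc (∣p∪q∣+∣p∩q∣≡∣p∣+∣q∣ p q)) (sym (+-suc _ _))
∣p∪q∣+∣p∩q∣≡∣p∣+∣q∣ (outside ∷ p) (outside ∷ q) = ∣p∪q∣+∣p∩q∣≡∣p∣+∣q∣ p q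

∣p∣+∣q∣≤∣p∩q∣+n : (p q : Subset N) → (∣ p ∣) + (∣ q ∣) ≤ (∣ p ∩ q ∣) + N
∣p∣+∣q∣≤∣p∩q∣+n {N} p q = begin
  (∣ p ∣) + (∣ q ∣)      ≡⟨ ∣p∪q∣+∣p∩q∣≡∣p∣+∣q∣ p q ⟨
  (∣ p ∪ q ∣) + (∣ p ∩ q ∣)  ≤⟨ +-monoˡ-≤ ∣ p ∩ q ∣ (∣p∣≤n (p ∪ q)) ⟩
  N + (∣ p ∩ q ∣)        ≡⟨ +-comm N ∣ p ∩ q ∣ ⟩
  (∣ p ∩ q ∣) + N        ∎
  where open ≤-Reasoning

Additive : (Subset k → ℕ) → Set
Additive μ = ∀ p q → p ∩ q ≡ ⊥ → μ (p ∪ q) ≡ μ p + μ q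

additive-tail : {μ : Subset (suc k) → ℕ} → Additive μ → Additive (μ ∘ (outside ∷_))
additive-tail add p q p∩q≡⊥ = add (outside ∷ p) (outside ∷ q) (cong (outside ∷_) p∩q≡⊥)

additive-head : {μ : Subset (suc k) → ℕ} → Additive μ →
                ∀ D → μ (inside ∷ D) ≡ μ ⁅ zero ⁆ + μ (outside ∷ D)
additive-head {μ = μ} add D = begin
  μ (inside ∷ D)                ≡⟨ cong (μ ∘ (inside ∷_)) (∪-identityˡ D) ⟨
  μ (⁅ zero ⁆ ∪ (outside ∷ D))  ≡⟨ add ⁅ zero ⁆ (outside ∷ D) (cong (outside ∷_) (∩-zeroˡ D)) ⟩
  μ ⁅ zero ⁆ + μ (outside ∷ D)  ∎
  where open ≡-Reasoning

private
  exclude-first : ∀ {m k a T x} → suc m * a ≤ x → suc m * T ≤ k * x →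
                  suc m * (a + T) ≤ suc k * x
  exclude-first {m} {k} {a} {T} {x} a≤ T≤ = begin
    suc m * (a + T)        ≡⟨ *-distribˡ-+ (suc m) a T ⟩
    suc m * a + suc m * T  ≤⟨ +-mono-≤ a≤ T≤ ⟩
    suc k * x              ∎
    where open ≤-Reasoning

  light-first : ∀ n .{{_ : NonZero n}} {k a T x} → x ≤ n * a → n * T ≤ k * x → T ≤ k * a
  light-first n {k} {a} {T} {x} x≤ T≤ = *-cancelˡ-≤ n (begin
    n * T        ≤⟨ T≤ ⟩
    k * x        ≤⟨ *-monoʳ-≤ k x≤ ⟩
    k * (n * a)  ≡⟨ x∙yz≈y∙xz k n a ⟩
    n * (k * a)  ∎)
    where open ≤-Reasoning

  -- Multiplied by k = m + 1 + r, the goal follows from k(m+1)T = (r+1)T + (k+1)mT.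
  include-first : ∀ {m k a T x} → suc m ≤ k → T ≤ k * a → m * T ≤ k * x →
                  suc m * (a + T) ≤ suc k * (a + x)
  include-first {m} {a = a} {T} {x} sm≤k T≤ mT≤ with r , refl ← m≤n⇒∃[o]m+o≡n sm≤k = begin
    suc m * (a + T)                                 ≡⟨ *-distribˡ-+ (suc m) a T ⟩
    suc m * a + suc m * T                           ≤⟨ +-monoʳ-≤ (suc m * a) (*-cancelˡ-≤ (suc m + r) scaled) ⟩
    suc m * a + (suc r * a + suc (suc m + r) * x)  ≡⟨ regroup m r a x ⟩
    suc (suc m + r) * (a + x)                       ∎
    where
    open ≤-Reasoning
    expand : ∀ m r T → (suc m + r) * (suc m * T) ≡ suc r * T + suc (suc m + r) * (m * T)
    expand = solve-∀
    collect : ∀ m r a x → suc r * ((suc m + r) * a) + suc (suc m + r) * ((suc m + r) * x)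
                          ≡ (suc m + r) * (suc r * a + suc (suc m + r) * x)
    collect = solve-∀
    regroup : ∀ m r a x → suc m * a + (suc r * a + suc (suc m + r) * x) ≡ suc (suc m + r) * (a + x)
    regroup = solve-∀
    scaled : (suc m + r) * (suc m * T) ≤ (suc m + r) * (suc r * a + suc (suc m + r) * x)
    scaled = begin
      (suc m + r) * (suc m * T)                                      ≡⟨ expand m r T ⟩
      suc r * T + suc (suc m + r) * (m * T)
        ≤⟨ +-mono-≤ (*-monoʳ-≤ (suc r) T≤) (*-monoʳ-≤ (suc (suc m + r)) mT≤) ⟩
      suc r * ((suc m + r) * a) + suc (suc m + r) * ((suc m + r) * x) ≡⟨ collect m r a x ⟩
      (suc m + r) * (suc r * a + suc (suc m + r) * x)                ∎

-- Either element zero is left out and m + 1 of the rest are taken, or, when that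
-- fails, element zero is heavy enough to be added to m of the rest.
heaviestSubset : (μ : Subset k → ℕ) → Additive μ → ∀ m → m ≤ k →
                 ∃[ D ] ∣ D ∣ ≡ m × m * μ ⊤ ≤ k * μ D
heaviestSubset {k} μ add zero _ = ⊥ , ∣⊥∣≡0 k , z≤n
heaviestSubset {suc k} μ add (suc m) (s≤s m≤k) with m≤n⇒m<n∨m≡n m≤k
... | inj₂ refl = ⊤ , ∣⊤∣≡n (suc m) , ≤-refl
... | inj₁ m<k
  with D₁ , ∣D₁∣≡ , avg₁ ← heaviestSubset (μ ∘ (outside ∷_)) (additive-tail {μ = μ} add) (suc m) m<k
     | D₂ , ∣D₂∣≡ , avg₂ ← heaviestSubset (μ ∘ (outside ∷_)) (additive-tail {μ = μ} add) m m≤k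
  with suc m * μ ⁅ zero ⁆ ≤? μ (outside ∷ D₁)
... | yes heavy = outside ∷ D₁ , ∣D₁∣≡ ,
  subst (λ z → suc m * z ≤ suc k * μ (outside ∷ D₁)) (sym (additive-head {μ = μ} add ⊤))
    (exclude-first {m} {k} heavy avg₁)
... | no light = inside ∷ D₂ , cong suc ∣D₂∣≡ ,
  subst₂ (λ y z → suc m * y ≤ suc k * z)
    (sym (additive-head {μ = μ} add ⊤)) (sym (additive-head {μ = μ} add D₂))
    (include-first {m} {k} m<k (light-first (suc m) {k} (<⇒≤ (≰⇒> light)) avg₁) avg₂)

preimage : (Fin N → Fin k) → Subset k → Subset N
preimage col D = tabulate (lookup D ∘ col)

∈-preimage⁻ : (col : Fin N → Fin k) {D : Subset k} {i : Fin N} →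
              i ∈ˢ preimage col D → col i ∈ˢ D
∈-preimage⁻ col {D} {i} i∈ =
  lookup⇒[]= (col i) D (trans (sym (lookup∘tabulate _ i)) ([]=⇒lookup i∈))

preimage-zipWith : (col : Fin N → Fin k) (f : Bool → Bool → Bool) (p q : Subset k) →
                   preimage col (zipWith f p q) ≡ zipWith f (preimage col p) (preimage col q)
preimage-zipWith col f p q =
  trans (tabulate-cong (λ i → lookup-zipWith f (col i) p q)) (sym (zipWith-tabulate _ _))
  where
  zipWith-tabulate : (g h : Fin N → Bool) →
                     zipWith f (tabulate g) (tabulate h) ≡ tabulate (λ i → f (g i) (h i))
  zipWith-tabulate {zero} g h = refl
  zipWith-tabulate {suc N} g h = cong (f (g zero) (h zero) ∷_) (zipWith-tabulate (g ∘ suc) (h ∘ suc))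

preimage-replicate : (col : Fin N → Fin k) (b : Bool) → preimage col (replicate k b) ≡ replicate N b
preimage-replicate {N} col b = begin
  tabulate (lookup (replicate _ b) ∘ col)
    ≡⟨ tabulate-cong (λ i → trans (lookup-replicate (col i) b) (sym (lookup-replicate i b))) ⟩
  tabulate (lookup (replicate N b))        ≡⟨ tabulate∘lookup (replicate N b) ⟩
  replicate N b                            ∎
  where open ≡-Reasoning

∣preimage⊤∣ : (col : Fin N → Fin k) → ∣ preimage col ⊤ ∣ ≡ N
∣preimage⊤∣ {N} col = trans (cong ∣_∣ (preimage-replicate col inside)) (∣⊤∣≡n N)

∣preimage∣-additive : (col : Fin N → Fin k) → Additive (λ D → ∣ preimage col D ∣)
∣preimage∣-additive {N} col p q p∩q≡⊥ = begin
  ∣ preimage col (p ∪ q) ∣           ≡⟨ cong ∣_∣ (preimage-zipWith col _ p q) ⟩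
  ∣ P ∪ Q ∣                          ≡⟨ +-identityʳ _ ⟨
  (∣ P ∪ Q ∣) + 0                    ≡⟨ cong ((∣ P ∪ Q ∣) +_) (trans (cong ∣_∣ P∩Q≡⊥) (∣⊥∣≡0 N)) ⟨
  (∣ P ∪ Q ∣) + (∣ P ∩ Q ∣)          ≡⟨ ∣p∪q∣+∣p∩q∣≡∣p∣+∣q∣ P Q ⟩
  (∣ P ∣) + (∣ Q ∣)                  ∎
  where
  open ≡-Reasoning
  P = preimage col p
  Q = preimage col q
  P∩Q≡⊥ : P ∩ Q ≡ ⊥
  P∩Q≡⊥ = trans (sym (preimage-zipWith col _ p q))
                (trans (cong (preimage col) p∩q≡⊥) (preimage-replicate col outside))

colorsOf-⊆ : (col : Fin N → Fin k) {e : Subset N} {D : Subset k} →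
             (∀ {i} → i ∈ˢ e → col i ∈ˢ D) → colorsOf col e ⊆ D
colorsOf-⊆ col {e} coloursInD {j} j∈ with any? (λ i → (i ∈? e) ×-dec (col i ≟ j))
                                         | trans (sym (lookup∘tabulate _ j)) ([]=⇒lookup j∈)
... | yes (i , i∈e , refl) | _ = coloursInD i∈e
... | no _                 | ()

fewColoursCoverMany : ∀ r t (col : Fin (suc (2 * r) * t) → Fin k) → k ≤ suc (2 * r) →
                      ∃[ D ] ∣ D ∣ ≤ suc r × suc r * t ≤ ∣ preimage col D ∣
fewColoursCoverMany {k} r t col k≤ with k ≤? suc r
... | yes k≤r+1 = ⊤ , subst (_≤ suc r) (sym (∣⊤∣≡n k)) k≤r+1 ,
  subst (suc r * t ≤_) (sym (∣preimage⊤∣ col))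
    (*-monoˡ-≤ t (s≤s (m≤m+n r (r + 0))))
... | no k≰r+1
  with D , ∣D∣≡ , avg ← heaviestSubset _ (∣preimage∣-additive col) (suc r) (<⇒≤ (≰⇒> k≰r+1)) =
  D , ≤-reflexive ∣D∣≡ , *-cancelˡ-≤ (suc (2 * r)) (begin
    suc (2 * r) * (suc r * t)           ≡⟨ x∙yz≈y∙xz (suc (2 * r)) (suc r) t ⟩
    suc r * (suc (2 * r) * t)           ≡⟨ cong (suc r *_) (∣preimage⊤∣ col) ⟨
    suc r * ∣ preimage col ⊤ ∣          ≤⟨ avg ⟩
    k * ∣ preimage col D ∣              ≤⟨ *-monoˡ-≤ _ k≤ ⟩
    suc (2 * r) * ∣ preimage col D ∣    ∎)
  where open ≤-Reasoning

private
  sides : List Bool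
  sides = inside List.∷ [ outside ]

allSubsets : ∀ N → List (Subset N)
allSubsets zero = [ [] ]
allSubsets (suc N) = cartesianProductWith _∷_ sides (allSubsets N)

∈-allSubsets : (p : Subset N) → p ∈ allSubsets N
∈-allSubsets [] = here refl
∈-allSubsets (inside ∷ p) = ∈-cartesianProductWith⁺ _∷_ {xs = sides} (here refl) (∈-allSubsets p)
∈-allSubsets (outside ∷ p) = ∈-cartesianProductWith⁺ _∷_ {xs = sides} (there (here refl)) (∈-allSubsets p)

largeSubsets : ℕ → ℕ → Hypergraph
largeSubsets N s = record { n = N ; edges = filter (λ e → s ≤? ∣ e ∣) (allSubsets N) }

∈-largeSubsets⁺ : ∀ {N s} (e : Subset N) → s ≤ ∣ e ∣ → e ∈ edges (largeSubsets N s)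
∈-largeSubsets⁺ e = ∈-filter⁺ (λ e → _ ≤? ∣ e ∣) (∈-allSubsets e)

largeSubsets-intersecting : ∀ N s t → N + t ≤ s + s → IsIntersecting t (largeSubsets N s)
largeSubsets-intersecting N s t N+t≤2s e f e∈ f∈ = +-cancelˡ-≤ N t (∣ e ∩ f ∣) (begin
  N + t                      ≤⟨ N+t≤2s ⟩
  s + s                      ≤⟨ +-mono-≤ (large e∈) (large f∈) ⟩
  (∣ e ∣) + (∣ f ∣)          ≤⟨ ∣p∣+∣q∣≤∣p∩q∣+n e f ⟩
  (∣ e ∩ f ∣) + N            ≡⟨ +-comm (∣ e ∩ f ∣) N ⟩
  N + (∣ e ∩ f ∣)            ∎)
  where
  open ≤-Reasoning
  large : ∀ {e} → e ∈ edges (largeSubsets N s) → s ≤ ∣ e ∣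
  large = proj₂ ∘ ∈-filter⁻ (λ e → s ≤? ∣ e ∣) {xs = allSubsets N}

mainTheorem5 : (t c : ℕ) → 2 ≤ c → c ≤ t → (k : ℕ) → k < 2 * (c ∸ 1) →
    Σ Hypergraph (λ H → IsIntersecting t H × ¬ StronglyColorable c k H)
mainTheorem5 t (suc (suc r)) _ c≤t k k<2[c-1] =
  largeSubsets order s , largeSubsets-intersecting order s t order+t≤2s , uncolourable
  where
  order = suc (2 * r) * t
  s = suc r * t
  order+t≤2s : order + t ≤ s + s
  order+t≤2s = ≤-reflexive (double r t)
    where
    double : ∀ r t → suc (2 * r) * t + t ≡ suc r * t + suc r * t
    double = solve-∀
  k≤2r+1 : k ≤ suc (2 * r)
  k≤2r+1 = ≤-pred (subst (suc k ≤_) (cong suc (+-suc r (r + 0))) k<2[c-1])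
  uncolourable : ¬ StronglyColorable (suc (suc r)) k (largeSubsets order s)
  uncolourable (col , strong) with D , ∣D∣≤ , s≤∣e∣ ← fewColoursCoverMany r t col k≤2r+1 =
    1+n≰n (begin
      suc (suc r)                        ≡⟨ m≤n⇒m⊓n≡m (≤-trans c≤t (≤-trans (m≤n*m t (suc r)) s≤∣e∣)) ⟨
      suc (suc r) ⊓ ∣ e ∣                ≤⟨ strong e (∈-largeSubsets⁺ e s≤∣e∣) ⟩
      ∣ colorsOf col e ∣                 ≤⟨ p⊆q⇒∣p∣≤∣q∣ (colorsOf-⊆ col {D = D} (∈-preimage⁻ col)) ⟩
      ∣ D ∣                              ≤⟨ ∣D∣≤ ⟩
      suc r                              ∎)
    where
    open ≤-Reasoning
    e = preimage col D
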